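{- Let $\mathtt{I}$ be an instance of SPA-P and let $\mathtt{J}$ be the integer program associated with $\mathtt{I}$ (defined in the context). A feasible solution $S$ to $\mathtt{J}$ is optimal if and only if the corresponding stable matching $M=\{(s_i,p_j): x_{i,j}=1 \text{ in } S\}$ in $\mathtt{I}$ has maximum cardinality among all stable matchings in $\mathtt{I}$.
   Context: SPA-P instance: students $\mathcal{S}=\{s_1,\dots,s_{n_1}\}$, projects $\mathcal{P}=\{p_1,\dots,p_{n_2}\}$, lecturers $\mathcal{L}=\{l_1,\dots,l_{n_3}\}$. Each lecturer $l_k$ offers a non-empty set $P_k\subseteq\mathcal{P}$, and $P_1,\dots,P_{n_3}$ partition $\mathcal{P}$. Each student $s_i$ has an acceptable set $A_i\subseteq\mathcal{P}$ ranked in strict order of preference; each lecturer $l_k$ ranks $P_k$ in strict order. Each project $p_j$ has capacity $c_j\ge1$ and each lecturer $l_k$ capacity $d_k\ge1$ (positive integers). $(s_i,p_j)$ is acceptable if $p_j\in A_i$. A matching $M$ is a set of acceptable pairs with each student in at most one pair, $|M(p_j)|\le c_j$ and $|M(l_k)|\le d_k$, where $M(p_j)$ is the set of students assigned to $p_j$ and $M(l_k)$ the set of students assigned to projects in $P_k$; $M(s_i)$ is the project of $s_i$. A project (lecturer) is undersubscribed if it has fewer assigned students than its capacity, full if equal; $p_j$ is non-empty if $|M(p_j)|>0$. An acceptable pair $(s_i,p_j)\notin M$, with $p_j\in P_k$, is a blocking pair if $s_i$ is unassigned or prefers $p_j$ to $M(s_i)$, $p_j$ is undersubscribed, and either (a)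 $s_i\in M(l_k)$ and $l_k$ prefers $p_j$ to $M(s_i)$, or (b) $s_i\notin M(l_k)$ and $l_k$ is undersubscribed, or (c) $s_i\notin M(l_k)$ and $l_k$ prefers $p_j$ to his worst non-empty project. A coalition is a set $\{s_{i_0},\dots,s_{i_{r-1}}\}$, $r\ge2$, of assigned students such that each $s_{i_t}$ prefers $M(s_{i_{t+1}})$ to $M(s_{i_t})$ (indices mod $r$). $M$ is stable if it has no blocking pair and no coalition. The IP $\mathtt{J}$: $rank(s_i,p_j)$ is $1+$ the number of projects $s_i$ prefers to $p_j$; similarly $rank(l_k,p_j)$. Let $S_{i,j}=\{p_{j'}\in A_i: rank(s_i,p_{j'})\le rank(s_i,p_j)\}$, $T_{k,j}=\{p_q\in P_k: rank(l_k,p_j)<rank(l_k,p_q)\}$, $D_{k,j}=\{p_{j'}\in P_k: rank(l_k,p_{j'})\le rank(l_k,p_j)\}$. Variables: binary $x_{i,j}$ for each acceptable pair $(s_i,p_j)$ (sums below range over existing variables only); binary $\alpha_j$ for each project; binary $\delta_k$ for each lecturer; binary $\eta_{j,k}$; binary $e_{i,i'}$ for each ordered pair of distinct students; integer $v_i$ for each student. Abbreviations: $\theta_{i,j}=1-\sum_{p_{j'}\in S_{i,j}}x_{i,j'}$, $\gamma_{i,j,k}=\sum_{p_{j'}\in T_{k,j}}x_{i,j'}$, $\beta_{i,k}=\sum_{p_{j'}\in P_k}x_{i,j'}$. Constraints: (1) $\sum_{p_j\in A_i}x_{i,j}\le1$ for all $i$; (2) $\sum_{i}x_{i,j}\le c_j$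 for all $j$; (3) $\sum_i\sum_{p_j\in P_k}x_{i,j}\le d_k$ for all $k$; (4) $c_j\alpha_j\ge c_j-\sum_{i'}x_{i',j}$ for all $j$; (5) $d_k\delta_k\ge d_k-\sum_{i'}\sum_{p_{j'}\in P_k}x_{i',j'}$ for all $k$; (6) $d_k\eta_{j,k}\ge d_k-\sum_{i'}\sum_{p_{j'}\in D_{k,j}}x_{i',j'}$ for all $k$ and $p_j\in P_k$; and for every acceptable pair $(s_i,p_j)$ with $p_j\in P_k$: (7) $\theta_{i,j}+\alpha_j+\gamma_{i,j,k}\le2$, (8) $\theta_{i,j}+\alpha_j+(1-\beta_{i,k})+\delta_k\le3$, (9) $\theta_{i,j}+\alpha_j+(1-\beta_{i,k})+\eta_{j,k}\le3$; (10) for all distinct $i,i'$ and all $j,j'$ such that $s_i$ prefers $p_{j'}$ to $p_j$: $e_{i,i'}+1\ge x_{i,j}+x_{i',j'}$; (11) for all distinct $i,i'$: $v_i<v_{i'}+n_1(1-e_{i,i'})$. Objective: maximise $\sum_i\sum_{p_j\in A_i}x_{i,j}$. A feasible solution is optimal if it maximises the objective among all feasible solutions. -}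

module Defs where

open import Data.Nat as ℕ using (ℕ; zero; suc; _≤_; _<_; _≤?_; _<?_)
open import Data.Integer as ℤ using (ℤ; +_)
open import Data.Fin using (Fin; zero; suc; toℕ; fromℕ<) renaming (_≟_ to _≟F_)
open import Data.Nat.DivMod using (_%_; m%n<n)
open import Data.List using (List; []; _∷_; filter)
open import Data.List.Membership.Propositional using (_∈_)
open import Data.List.Relation.Unary.Unique.Propositional using (Unique)
open import Data.Bool using (Bool; true; false; if_then_else_)
open import Data.Maybe using (Maybe)
open import Data.Product using (Σ; ∃; ∃-syntax; _×_; _,_)
open import Data.Sum using (_⊎_)
open import Function using (_⇔_)
open import Function.Definitions using (Injective)
open import Relation.Nullary using (¬_; does)
open import Relation.Binary.PropositionalEquality using (_≡_; _≢_)

sumFin : (n : ℕ) → (Fin n → ℕ) → ℕ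
sumFin zero    f = 0
sumFin (suc n) f = f zero ℕ.+ sumFin n (λ i → f (suc i))

sumFinZ : (n : ℕ) → (Fin n → ℤ) → ℤ
sumFinZ zero    f = + 0
sumFinZ (suc n) f = f zero ℤ.+ sumFinZ n (λ i → f (suc i))

sumL : ∀ {m} → List (Fin m) → (Fin m → ℕ) → ℕ
sumL []       f = 0
sumL (x ∷ xs) f = f x ℕ.+ sumL xs f

sumLZ : ∀ {m} → List (Fin m) → (Fin m → ℤ) → ℤ
sumLZ []       f = + 0
sumLZ (x ∷ xs) f = f x ℤ.+ sumLZ xs f

b2n : Bool → ℕ
b2n true  = 1
b2n false = 0

-- Ranks in a strictly ordered preference list (most preferred first).
-- rank L p = 1 + number of entries of L before p (meaningful when p ∈ L).

rank : ∀ {m} → List (Fin m) → Fin m → ℕ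
rank []       p = 0
rank (x ∷ xs) p = if does (x ≟F p) then 1 else suc (rank xs p)

Prefers : ∀ {m} → List (Fin m) → Fin m → Fin m → Set
Prefers L a b = a ∈ L × b ∈ L × rank L a < rank L b

next : ∀ {n} → Fin (suc n) → Fin (suc n)
next {n} t = fromℕ< (m%n<n (suc (toℕ t)) (suc n))

record Instance : Set where
  field
    n₁ n₂ n₃  : ℕ                         -- students, projects, lecturers
    lec       : Fin n₂ → Fin n₃
    A         : Fin n₁ → List (Fin n₂)    -- student preference lists
    A-unique  : ∀ i → Unique (A i)
    LP        : Fin n₃ → List (Fin n₂)    -- lecturer preference lists over P_k
    LP-unique : ∀ k → Unique (LP k)
    LP-exact  : ∀ k j → (j ∈ LP k) ⇔ (lec j ≡ k)
    lec-nonempty : ∀ k → ∃[ j ] (lec j ≡ k)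
    c         : Fin n₂ → ℕ                -- project capacities
    c-pos     : ∀ j → 1 ≤ c j
    d         : Fin n₃ → ℕ                -- lecturer capacities
    d-pos     : ∀ k → 1 ≤ d k

module _ (I : Instance) where
  open Instance I

  Rel : Set
  Rel = Fin n₁ → Fin n₂ → Bool

  projLoad : Rel → Fin n₂ → ℕ
  projLoad M j = sumFin n₁ (λ i → b2n (M i j))

  lecLoad : Rel → Fin n₃ → ℕ
  lecLoad M k = sumFin n₁ (λ i → sumL (LP k) (λ j → b2n (M i j)))

  card : Rel → ℕ
  card M = sumFin n₁ (λ i → sumFin n₂ (λ j → b2n (M i j)))

  record IsMatching (M : Rel) : Set where
    field
      acceptable : ∀ i j → M i j ≡ true → j ∈ A i
      atMostOne  : ∀ i j j' → M i j ≡ true → M i j' ≡ true → j ≡ j'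
      projCap    : ∀ j → projLoad M j ≤ c j
      lecCap     : ∀ k → lecLoad M k ≤ d k

  Unassigned : Rel → Fin n₁ → Set
  Unassigned M i = ∀ j → M i j ≡ false

  AssignedToLec : Rel → Fin n₁ → Fin n₃ → Set
  AssignedToLec M i k = ∃[ j ] (M i j ≡ true × lec j ≡ k)

  WorstNonEmpty : Rel → Fin n₃ → Fin n₂ → Set
  WorstNonEmpty M k w =
    lec w ≡ k × 0 < projLoad M w ×
    (∀ q → lec q ≡ k → 0 < projLoad M q → q ≡ w ⊎ Prefers (LP k) q w)

  BlockingPair : Rel → Fin n₁ → Fin n₂ → Set
  BlockingPair M i j =
    j ∈ A i × M i j ≡ false ×
    (Unassigned M i ⊎ ∃[ j' ] (M i j' ≡ true × Prefers (A i) j j')) ×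
    projLoad M j < c j ×
    ( (∃[ j' ] (M i j' ≡ true × lec j' ≡ lec j × Prefers (LP (lec j)) j j'))
    ⊎ (¬ AssignedToLec M i (lec j) × lecLoad M (lec j) < d (lec j))
    ⊎ (¬ AssignedToLec M i (lec j) ×
         ∃[ w ] (WorstNonEmpty M (lec j) w × Prefers (LP (lec j)) j w)) )

  record Coalition (M : Rel) : Set where
    field
      r        : ℕ
      r-pos    : 1 ≤ r
      f        : Fin (suc r) → Fin n₁
      f-inj    : Injective _≡_ _≡_ f
      g        : Fin (suc r) → Fin n₂
      assigned : ∀ t → M (f t) (g t) ≡ true
      improves : ∀ t → Prefers (A (f t)) (g (next t)) (g t)

  record Stable (M : Rel) : Set where
    field
      matching   : IsMatching M
      noBlocking : ∀ i j → ¬ BlockingPair M i j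
      noCoalition : ¬ Coalition M

  MaxCardStable : Rel → Set
  MaxCardStable M = Stable M × (∀ M' → Stable M' → card M' ≤ card M)

  record Solution : Set where
    field
      x : Fin n₁ → Fin n₂ → ℤ
      α : Fin n₂ → ℤ
      δ : Fin n₃ → ℤ
      η : Fin n₂ → Fin n₃ → ℤ
      e : Fin n₁ → Fin n₁ → ℤ
      v : Fin n₁ → ℤ

  Binary : ℤ → Set
  Binary z = z ≡ + 0 ⊎ z ≡ + 1

  Sset : Fin n₁ → Fin n₂ → List (Fin n₂)
  Sset i j = filter (λ j' → rank (A i) j' ≤? rank (A i) j) (A i)

  Tset : Fin n₃ → Fin n₂ → List (Fin n₂)
  Tset k j = filter (λ q → rank (LP k) j <? rank (LP k) q) (LP k)

  Dset : Fin n₃ → Fin n₂ → List (Fin n₂)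
  Dset k j = filter (λ j' → rank (LP k) j' ≤? rank (LP k) j) (LP k)

  module _ (S : Solution) where
    open Solution S

    θ : Fin n₁ → Fin n₂ → ℤ
    θ i j = + 1 ℤ.- sumLZ (Sset i j) (x i)

    γ : Fin n₁ → Fin n₂ → Fin n₃ → ℤ
    γ i j k = sumLZ (Tset k j) (x i)

    β : Fin n₁ → Fin n₃ → ℤ
    β i k = sumLZ (LP k) (x i)

    projSumZ : Fin n₂ → ℤ
    projSumZ j = sumFinZ n₁ (λ i' → x i' j)

    objective : ℤ
    objective = sumFinZ n₁ (λ i → sumLZ (A i) (x i))

    record Feasible : Set where
      field
        x-bin : ∀ i j → Binary (x i j)
        -- variables x_{i,j} exist only for acceptable pairs:
        -- a non-acceptable pair is identified with the value 0
        x-acc : ∀ i j → ¬ (j ∈ A i) → x i j ≡ + 0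
        α-bin : ∀ j → Binary (α j)
        δ-bin : ∀ k → Binary (δ k)
        η-bin : ∀ j k → Binary (η j k)
        e-bin : ∀ i i' → i ≢ i' → Binary (e i i')
        c1 : ∀ i → sumLZ (A i) (x i) ℤ.≤ + 1
        c2 : ∀ j → projSumZ j ℤ.≤ + c j
        c3 : ∀ k → sumFinZ n₁ (λ i → sumLZ (LP k) (x i)) ℤ.≤ + d k
        c4 : ∀ j → + c j ℤ.- projSumZ j ℤ.≤ + c j ℤ.* α j
        c5 : ∀ k → + d k ℤ.- sumFinZ n₁ (λ i' → sumLZ (LP k) (x i'))
                     ℤ.≤ + d k ℤ.* δ k
        c6 : ∀ k j → lec j ≡ k →
               + d k ℤ.- sumFinZ n₁ (λ i' → sumLZ (Dset k j) (x i'))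
                 ℤ.≤ + d k ℤ.* η j k
        c7 : ∀ i j → j ∈ A i →
               θ i j ℤ.+ α j ℤ.+ γ i j (lec j) ℤ.≤ + 2
        c8 : ∀ i j → j ∈ A i →
               θ i j ℤ.+ α j ℤ.+ (+ 1 ℤ.- β i (lec j)) ℤ.+ δ (lec j) ℤ.≤ + 3
        c9 : ∀ i j → j ∈ A i →
               θ i j ℤ.+ α j ℤ.+ (+ 1 ℤ.- β i (lec j)) ℤ.+ η j (lec j) ℤ.≤ + 3
        c10 : ∀ i i' j j' → i ≢ i' → Prefers (A i) j' j →
                x i j ℤ.+ x i' j' ℤ.≤ e i i' ℤ.+ + 1
        c11 : ∀ i i' → i ≢ i' →
                v i ℤ.< v i' ℤ.+ + n₁ ℤ.* (+ 1 ℤ.- e i i')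

  Optimal : Solution → Set
  Optimal S = Feasible S × (∀ S' → Feasible S' → objective S' ℤ.≤ objective S)

  matchingOf : Solution → Rel
  matchingOf S i j = does (Solution.x S i j ℤ.≟ + 1)

module Submission where

-- Both directions follow from a correspondence between feasible solutions and
-- stable matchings that preserves size (the objective of S equals |M(S)|):
--   * FromSolution: for a feasible S, constraints (1)-(3) make M(S) a matching;
--     a blocking pair would force θ = α = 1 together with γ = 1, δ = 1 or η = 1
--     (via the capacity indicators (4)-(6)), violating (7), (8) or (9); a
--     coalition would force e = 1 along a cycle by (10), so by (11) the integers v
--     would strictly increase around that cycle.
--   * FromStable: a stable M is encoded by setting every indicator to its intended
--     meaning, and v_i = n₁ - H_i, where H_i is the length of a longest envy walk
--     from s_i; such walks are finite because an envy cycle would contain a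
--     coalition.

open import Defs
open import Data.Bool using (Bool; true; false; if_then_else_)
import Data.Bool.Properties as BoolP
open import Data.Empty using (⊥; ⊥-elim)
open import Data.Fin using (Fin; zero; suc; toℕ)
open import Data.Fin.Properties using (_≟_; toℕ-fromℕ<; toℕ-injective; toℕ<n; pigeonhole)
import Data.Fin.Properties as FinP
open import Data.Integer as ℤ using (ℤ; +≤+; +<+) renaming (+_ to pos)
import Data.Integer.Properties as ℤP
open import Data.List using (List; []; _∷_; filter; allFin)
open import Data.List.Membership.Propositional using (_∈_; _∉_)
open import Data.List.Membership.Propositional.Properties using (∈-filter⁺; ∈-filter⁻; ∈-allFin)
import Data.List.Membership.DecPropositional as DecMembership
open import Data.List.Relation.Unary.Any as Any using (here; there)
import Data.List.Relation.Unary.All as All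
open import Data.List.Relation.Unary.AllPairs using (_∷_)
open import Data.List.Relation.Unary.Unique.Propositional using (Unique)
import Data.List.Relation.Unary.Unique.Propositional.Properties as UniqueP
import Data.List.Extrema
open import Data.List.Extrema.Nat using (argmax; argmax-all; v≤f[argmax]⁺)
open import Data.Nat as ℕ using (ℕ; zero; suc; _≤_; _<_; _+_; _∸_; z≤n; s≤s; _≤?_; _<?_)
import Data.Nat.Properties as NP
open import Algebra.Properties.CommutativeSemigroup NP.+-commutativeSemigroup
  using (interchange; x∙yz≈y∙xz)
open import Data.Nat.DivMod using (_%_; m≤n⇒m%n≡m; n%n≡0)
open import Data.Product using (Σ; ∃-syntax; _×_; _,_; proj₁; proj₂)
open import Data.Sum using (_⊎_; inj₁; inj₂)
open import Function using (Equivalence)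
open import Function.Definitions using (Injective)
open import Relation.Binary.Definitions using (tri<; tri≈; tri>)
open import Relation.Nullary using (¬_; Dec; yes; no; does)
open import Relation.Nullary.Decidable using (True; toWitness; _×-dec_; ¬?; decidable-stable)
open import Relation.Unary using (Pred; Decidable)
open import Relation.Binary.PropositionalEquality
  using (_≡_; _≢_; refl; sym; trans; cong; cong₂; subst; subst₂; module ≡-Reasoning)

not-positive : ∀ {n} → ¬ 1 ≤ n → n ≡ 0
not-positive ¬1≤n = NP.n<1⇒n≡0 (NP.≰⇒> ¬1≤n)

erase : ∀ {a p} {A : Set a} {P : Pred A p} → Decidable P → (A → ℕ) → A → ℕ
erase P? f z = if does (P? z) then 0 else f z

erase-no : ∀ {a p} {A : Set a} {P : Pred A p} (P? : Decidable P) (f : A → ℕ) {z} →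
  ¬ P z → erase P? f z ≡ f z
erase-no P? f {z} ¬Pz with P? z
... | yes Pz = ⊥-elim (¬Pz Pz)
... | no _   = refl

erase-positive : ∀ {a p} {A : Set a} {P : Pred A p} (P? : Decidable P) (f : A → ℕ) {z} →
  1 ≤ erase P? f z → ¬ P z × 1 ≤ f z
erase-positive P? f {z} 1≤ with P? z
... | yes _ = ⊥-elim (NP.<⇒≱ 1≤ z≤n)
... | no ¬Pz = ¬Pz , 1≤

sumFin-ext : ∀ n {f g : Fin n → ℕ} → (∀ i → f i ≡ g i) → sumFin n f ≡ sumFin n g
sumFin-ext zero    f≗g = refl
sumFin-ext (suc n) f≗g = cong₂ _+_ (f≗g zero) (sumFin-ext n (λ i → f≗g (suc i)))

sumFin-zero : ∀ n {f : Fin n → ℕ} → (∀ i → f i ≡ 0) → sumFin n f ≡ 0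
sumFin-zero zero    f≗0 = refl
sumFin-zero (suc n) f≗0 = cong₂ _+_ (f≗0 zero) (sumFin-zero n (λ i → f≗0 (suc i)))

sumFin-+ : ∀ n (f g : Fin n → ℕ) →
  sumFin n (λ i → f i + g i) ≡ sumFin n f + sumFin n g
sumFin-+ zero    f g = refl
sumFin-+ (suc n) f g = begin
  (f zero + g zero) + sumFin n (λ i → f (suc i) + g (suc i))
    ≡⟨ cong ((f zero + g zero) +_) (sumFin-+ n (λ i → f (suc i)) (λ i → g (suc i))) ⟩
  (f zero + g zero) + (sumFin n (λ i → f (suc i)) + sumFin n (λ i → g (suc i)))
    ≡⟨ interchange (f zero) (g zero) _ _ ⟩
  (f zero + sumFin n (λ i → f (suc i))) + (g zero + sumFin n (λ i → g (suc i))) ∎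
  where open ≡-Reasoning

sumFin-mono : ∀ n {f g : Fin n → ℕ} → (∀ i → f i ≤ g i) → sumFin n f ≤ sumFin n g
sumFin-mono zero    f≤g = z≤n
sumFin-mono (suc n) f≤g = NP.+-mono-≤ (f≤g zero) (sumFin-mono n (λ i → f≤g (suc i)))

sumFin-term : ∀ n (f : Fin n → ℕ) a → f a ≤ sumFin n f
sumFin-term (suc n) f zero    = NP.m≤m+n (f zero) _
sumFin-term (suc n) f (suc a) =
  NP.≤-trans (sumFin-term n (λ i → f (suc i)) a) (NP.m≤n+m _ (f zero))

sumFin-positive : ∀ n (f : Fin n → ℕ) → 1 ≤ sumFin n f → ∃[ a ] (1 ≤ f a)
sumFin-positive zero    f ()
sumFin-positive (suc n) f 1≤ with 1 ≤? f zero
... | yes f0 = zero , f0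
... | no ¬f0 with sumFin-positive n (λ i → f (suc i))
                    (subst (λ m → 1 ≤ m + sumFin n (λ i → f (suc i))) (not-positive ¬f0) 1≤)
...   | a , fa = suc a , fa

sumFin-point : ∀ n (f : Fin n → ℕ) a → sumFin n f ≡ f a + sumFin n (erase (_≟ a) f)
sumFin-point (suc n) f zero    = refl
sumFin-point (suc n) f (suc a) = begin
  f zero + sumFin n (λ i → f (suc i))
    ≡⟨ cong (f zero +_) (sumFin-point n (λ i → f (suc i)) a) ⟩
  f zero + (f (suc a) + sumFin n (erase (_≟ a) (λ i → f (suc i))))
    ≡⟨ x∙yz≈y∙xz (f zero) (f (suc a)) _ ⟩
  f (suc a) + (f zero + sumFin n (erase (_≟ a) (λ i → f (suc i)))) ∎
  where open ≡-Reasoning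

sumL-term : ∀ {m} {L : List (Fin m)} (f : Fin m → ℕ) {z} → z ∈ L → f z ≤ sumL L f
sumL-term f (here refl) = NP.m≤m+n _ _
sumL-term {L = x ∷ _} f (there z∈) = NP.≤-trans (sumL-term f z∈) (NP.m≤n+m _ (f x))

sumL-ext : ∀ {m} (L : List (Fin m)) {f g : Fin m → ℕ} →
  (∀ z → z ∈ L → f z ≡ g z) → sumL L f ≡ sumL L g
sumL-ext []       f≗g = refl
sumL-ext (x ∷ xs) f≗g = cong₂ _+_ (f≗g x (here refl)) (sumL-ext xs (λ z z∈ → f≗g z (there z∈)))

sumL-zero : ∀ {m} (L : List (Fin m)) {f : Fin m → ℕ} → (∀ z → z ∈ L → f z ≡ 0) → sumL L f ≡ 0
sumL-zero []       f≗0 = refl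
sumL-zero (x ∷ xs) f≗0 = cong₂ _+_ (f≗0 x (here refl)) (sumL-zero xs (λ z z∈ → f≗0 z (there z∈)))

sumL-positive : ∀ {m} (L : List (Fin m)) (f : Fin m → ℕ) →
  1 ≤ sumL L f → ∃[ z ] (z ∈ L × 1 ≤ f z)
sumL-positive []       f ()
sumL-positive (x ∷ xs) f 1≤ with 1 ≤? f x
... | yes fx = x , here refl , fx
... | no ¬fx with sumL-positive xs f
                    (subst (λ m → 1 ≤ m + sumL xs f) (not-positive ¬fx) 1≤)
...   | z , z∈ , fz = z , there z∈ , fz

sumL-two : ∀ {m} {L : List (Fin m)} (f : Fin m → ℕ) → Unique L →
  ∀ {a b} → a ∈ L → b ∈ L → a ≢ b → f a + f b ≤ sumL L f
sumL-two f _ (here refl) (here refl) a≢b = ⊥-elim (a≢b refl)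
sumL-two f _ (here refl) (there b∈) _ = NP.+-monoʳ-≤ (f _) (sumL-term f b∈)
sumL-two {L = x ∷ xs} f _ (there a∈) (here refl) _ =
  subst (_≤ sumL (x ∷ xs) f) (NP.+-comm (f x) _) (NP.+-monoʳ-≤ (f x) (sumL-term f a∈))
sumL-two {L = x ∷ xs} f (_ ∷ u) (there a∈) (there b∈) a≢b =
  NP.≤-trans (sumL-two f u a∈ b∈ a≢b) (NP.m≤n+m _ (f x))

sumL-≤1 : ∀ {m} {L : List (Fin m)} (f : Fin m → ℕ) → Unique L → (∀ z → f z ≤ 1) →
  (∀ a b → 1 ≤ f a → 1 ≤ f b → a ≡ b) → sumL L f ≤ 1
sumL-≤1 {L = []}     f _ _ _ = z≤n
sumL-≤1 {L = x ∷ xs} f (x∉ ∷ u) f≤1 single with 1 ≤? f x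
... | no ¬fx = subst (λ n → n + sumL xs f ≤ 1) (sym (not-positive ¬fx))
                     (sumL-≤1 f u f≤1 single)
... | yes fx = subst (λ n → f x + n ≤ 1) (sym (sumL-zero xs rest))
                     (subst (_≤ 1) (sym (NP.+-identityʳ (f x))) (f≤1 x))
  where
  rest : ∀ z → z ∈ xs → f z ≡ 0
  rest z z∈ with 1 ≤? f z
  ... | yes fz = ⊥-elim (All.lookup x∉ z∈ (single x z fx fz))
  ... | no ¬fz = not-positive ¬fz

sumL-filter : ∀ {m p} {P : Pred (Fin m) p} (P? : Decidable P) (L : List (Fin m)) (f : Fin m → ℕ) →
  sumL L f ≡ sumL (filter P? L) f + sumL L (erase P? f)
sumL-filter P? []       f = refl
sumL-filter P? (x ∷ xs) f with P? x
... | yes _ = trans (cong (f x +_) (sumL-filter P? xs f)) (sym (NP.+-assoc (f x) _ _))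
... | no _  = trans (cong (f x +_) (sumL-filter P? xs f))
                    (x∙yz≈y∙xz (f x) (sumL (filter P? xs) f) _)

sumL-filter-≤ : ∀ {m p} {P : Pred (Fin m) p} (P? : Decidable P) (L : List (Fin m)) (f : Fin m → ℕ) →
  sumL (filter P? L) f ≤ sumL L f
sumL-filter-≤ P? L f = subst (sumL (filter P? L) f ≤_) (sym (sumL-filter P? L f)) (NP.m≤m+n _ _)

sumL-filter-+ : ∀ {m p} {P : Pred (Fin m) p} (P? : Decidable P) {L : List (Fin m)}
  (f : Fin m → ℕ) {w} → w ∈ L → ¬ P w → sumL (filter P? L) f + f w ≤ sumL L f
sumL-filter-+ P? {L} f {w} w∈ ¬Pw =
  subst (sumL (filter P? L) f + f w ≤_) (sym (sumL-filter P? L f))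
    (NP.+-monoʳ-≤ (sumL (filter P? L) f)
      (subst (_≤ sumL L (erase P? f)) (erase-no P? f ¬Pw) (sumL-term (erase P? f) w∈)))

-- for f supported on a duplicate-free list L, the sum over L is the sum over Fin n:
-- split off the head x of L and erase f at x
sumL≡sumFin : ∀ {n} (L : List (Fin n)) → Unique L → (f : Fin n → ℕ) →
  (∀ j → j ∉ L → f j ≡ 0) → sumL L f ≡ sumFin n f
sumL≡sumFin {n} [] _ f supported = sym (sumFin-zero n (λ j → supported j λ ()))
sumL≡sumFin {n} (x ∷ xs) (x∉ ∷ u) f supported = begin
  f x + sumL xs f                      ≡⟨ cong (f x +_) (sumL-ext xs keep) ⟨
  f x + sumL xs (erase (_≟ x) f)       ≡⟨ cong (f x +_) (sumL≡sumFin xs u (erase (_≟ x) f) erased) ⟩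
  f x + sumFin n (erase (_≟ x) f)      ≡⟨ sumFin-point n f x ⟨
  sumFin n f                           ∎
  where
  open ≡-Reasoning
  keep : ∀ z → z ∈ xs → erase (_≟ x) f z ≡ f z
  keep z z∈ = erase-no (_≟ x) f (λ z≡x → All.lookup x∉ z∈ (sym z≡x))
  erased : ∀ j → j ∉ xs → erase (_≟ x) f j ≡ 0
  erased j j∉ with j ≟ x
  ... | yes _   = refl
  ... | no j≢x  = supported j λ { (here j≡x) → j≢x j≡x ; (there j∈) → j∉ j∈ }

sumLZ-pos : ∀ {m} (L : List (Fin m)) (f : Fin m → ℕ) → sumLZ L (λ z → pos (f z)) ≡ pos (sumL L f)
sumLZ-pos []       f = refl
sumLZ-pos (x ∷ xs) f = cong (λ s → pos (f x) ℤ.+ s) (sumLZ-pos xs f)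

sumFinZ-pos : ∀ n (f : Fin n → ℕ) → sumFinZ n (λ i → pos (f i)) ≡ pos (sumFin n f)
sumFinZ-pos zero    f = refl
sumFinZ-pos (suc n) f = cong (λ s → pos (f zero) ℤ.+ s) (sumFinZ-pos n (λ i → f (suc i)))

sumLZ-ext : ∀ {m} (L : List (Fin m)) {f g : Fin m → ℤ} → (∀ z → f z ≡ g z) → sumLZ L f ≡ sumLZ L g
sumLZ-ext []       f≗g = refl
sumLZ-ext (x ∷ xs) f≗g = cong₂ ℤ._+_ (f≗g x) (sumLZ-ext xs f≗g)

sumFinZ-ext : ∀ n {f g : Fin n → ℤ} → (∀ i → f i ≡ g i) → sumFinZ n f ≡ sumFinZ n g
sumFinZ-ext zero    f≗g = refl
sumFinZ-ext (suc n) f≗g = cong₂ ℤ._+_ (f≗g zero) (sumFinZ-ext n (λ i → f≗g (suc i)))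

decide≤ : ∀ {a b : ℤ} {ok : True (a ℤP.≤? b)} → a ℤ.≤ b
decide≤ {ok = ok} = toWitness ok

b2n-binary : ∀ b → pos (b2n b) ≡ pos 0 ⊎ pos (b2n b) ≡ pos 1
b2n-binary true  = inj₂ refl
b2n-binary false = inj₁ refl

b2n≤1 : ∀ b → b2n b ≤ 1
b2n≤1 true  = s≤s z≤n
b2n≤1 false = z≤n

b2n-does : ∀ {P : Set} (D : Dec P) → 1 ≤ b2n (does D) → P
b2n-does (yes p) _ = p
b2n-does (no _) ()

minus-pos : ∀ {b c} → b ≤ c → pos c ℤ.- pos b ≡ pos (c ∸ b)
minus-pos {b} {c} b≤c = trans (ℤP.m-n≡m⊖n c b) (ℤP.⊖-≥ b≤c)

-- Capacity-indicator constraints (4)-(6) have the form c - load ≤ c * a.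
-- If the load is below capacity, a binary a must be 1 ...
indicator-forced : ∀ {c load} {s a : ℤ} → load < c → a ≡ pos 0 ⊎ a ≡ pos 1 →
  s ≡ pos load → pos c ℤ.- s ℤ.≤ pos c ℤ.* a → a ≡ pos 1
indicator-forced _ (inj₂ a≡1) _ _ = a≡1
indicator-forced {c} {load} under (inj₁ refl) refl le
  rewrite ℤP.*-zeroʳ (pos c) | minus-pos (NP.<⇒≤ under) =
  ⊥-elim (NP.<⇒≱ (NP.m<n⇒0<n∸m under) (ℤP.drop‿+≤+ le))

-- ... and the indicator of "load < c" always satisfies the constraint.
indicator-valid : ∀ {s} c load → s ≡ pos load → load ≤ c → (under? : Dec (load < c)) →
  pos c ℤ.- s ℤ.≤ pos c ℤ.* pos (b2n (does under?))
indicator-valid c load refl le (yes _)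
  rewrite ℤP.*-identityʳ (pos c) | minus-pos le = +≤+ (NP.m∸n≤m c load)
indicator-valid c load refl le (no ¬under)
  rewrite ℤP.*-zeroʳ (pos c) | NP.≤-antisym le (NP.≮⇒≥ ¬under)
        | minus-pos (NP.≤-refl {c}) | NP.n∸n≡0 c = +≤+ z≤n

c7-violated : ∀ {σ α γ : ℤ} {g} → σ ≡ pos 0 → α ≡ pos 1 → γ ≡ pos g → 1 ≤ g →
  ¬ (pos 1 ℤ.- σ ℤ.+ α ℤ.+ γ ℤ.≤ pos 2)
c7-violated refl refl refl (s≤s z≤n) (+≤+ (s≤s (s≤s ())))

c89-violated : ∀ {σ α β ζ : ℤ} → σ ≡ pos 0 → α ≡ pos 1 → β ≡ pos 0 → ζ ≡ pos 1 →
  ¬ (pos 1 ℤ.- σ ℤ.+ α ℤ.+ (pos 1 ℤ.- β) ℤ.+ ζ ℤ.≤ pos 3)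
c89-violated refl refl refl refl (+≤+ (s≤s (s≤s (s≤s ()))))

envy-forced : ∀ {a b e : ℤ} → a ≡ pos 1 → b ≡ pos 1 → e ≡ pos 0 ⊎ e ≡ pos 1 →
  a ℤ.+ b ℤ.≤ e ℤ.+ pos 1 → e ≡ pos 1
envy-forced _ _ (inj₂ e≡1) _ = e≡1
envy-forced refl refl (inj₁ refl) (+≤+ (s≤s ()))

potential-increases : ∀ {a b e : ℤ} n → e ≡ pos 1 → a ℤ.< b ℤ.+ pos n ℤ.* (pos 1 ℤ.- e) → a ℤ.< b
potential-increases {b = b} n refl lt rewrite ℤP.*-zeroʳ (pos n) | ℤP.+-identityʳ b = lt

c7-table : ∀ {σ γ : ℤ} {s a g} → σ ≡ pos s → γ ≡ pos g → s ≤ 1 → a ≤ 1 → g ≤ 1 →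
  ¬ (s ≡ 0 × 1 ≤ a × 1 ≤ g) → pos 1 ℤ.- σ ℤ.+ pos a ℤ.+ γ ℤ.≤ pos 2
c7-table refl refl z≤n       (s≤s z≤n) (s≤s z≤n) ok = ⊥-elim (ok (refl , s≤s z≤n , s≤s z≤n))
c7-table refl refl z≤n       z≤n       z≤n       _ = decide≤
c7-table refl refl z≤n       z≤n       (s≤s z≤n) _ = decide≤
c7-table refl refl z≤n       (s≤s z≤n) z≤n       _ = decide≤
c7-table refl refl (s≤s z≤n) z≤n       z≤n       _ = decide≤
c7-table refl refl (s≤s z≤n) z≤n       (s≤s z≤n) _ = decide≤
c7-table refl refl (s≤s z≤n) (s≤s z≤n) z≤n       _ = decide≤
c7-table refl refl (s≤s z≤n) (s≤s z≤n) (s≤s z≤n) _ = decide≤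

c89-table : ∀ {σ β : ℤ} {s a b q} → σ ≡ pos s → β ≡ pos b → s ≤ 1 → a ≤ 1 → b ≤ 1 → q ≤ 1 →
  ¬ (s ≡ 0 × 1 ≤ a × b ≡ 0 × 1 ≤ q) →
  pos 1 ℤ.- σ ℤ.+ pos a ℤ.+ (pos 1 ℤ.- β) ℤ.+ pos q ℤ.≤ pos 3
c89-table refl refl z≤n (s≤s z≤n) z≤n (s≤s z≤n) ok = ⊥-elim (ok (refl , s≤s z≤n , refl , s≤s z≤n))
c89-table refl refl z≤n       z≤n       z≤n       z≤n       _ = decide≤
c89-table refl refl z≤n       z≤n       z≤n       (s≤s z≤n) _ = decide≤
c89-table refl refl z≤n       z≤n       (s≤s z≤n) z≤n       _ = decide≤
c89-table refl refl z≤n       z≤n       (s≤s z≤n) (s≤s z≤n) _ = decide≤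
c89-table refl refl z≤n       (s≤s z≤n) z≤n       z≤n       _ = decide≤
c89-table refl refl z≤n       (s≤s z≤n) (s≤s z≤n) z≤n       _ = decide≤
c89-table refl refl z≤n       (s≤s z≤n) (s≤s z≤n) (s≤s z≤n) _ = decide≤
c89-table refl refl (s≤s z≤n) z≤n       z≤n       z≤n       _ = decide≤
c89-table refl refl (s≤s z≤n) z≤n       z≤n       (s≤s z≤n) _ = decide≤
c89-table refl refl (s≤s z≤n) z≤n       (s≤s z≤n) z≤n       _ = decide≤
c89-table refl refl (s≤s z≤n) z≤n       (s≤s z≤n) (s≤s z≤n) _ = decide≤
c89-table refl refl (s≤s z≤n) (s≤s z≤n) z≤n       z≤n       _ = decide≤
c89-table refl refl (s≤s z≤n) (s≤s z≤n) z≤n       (s≤s z≤n) _ = decide≤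
c89-table refl refl (s≤s z≤n) (s≤s z≤n) (s≤s z≤n) z≤n       _ = decide≤
c89-table refl refl (s≤s z≤n) (s≤s z≤n) (s≤s z≤n) (s≤s z≤n) _ = decide≤

c10-table : ∀ (a b : Bool) {P : Set} (D : Dec P) → (a ≡ true → b ≡ true → P) →
  pos (b2n a) ℤ.+ pos (b2n b) ℤ.≤ pos (b2n (does D)) ℤ.+ pos 1
c10-table true  true  (yes _) _    = decide≤
c10-table true  true  (no ¬p) envy = ⊥-elim (¬p (envy refl refl))
c10-table true  false (yes _) _    = decide≤
c10-table true  false (no _)  _    = decide≤
c10-table false true  (yes _) _    = decide≤
c10-table false true  (no _)  _    = decide≤
c10-table false false (yes _) _    = decide≤
c10-table false false (no _)  _    = decide≤

-- Constraint (11) for the potential v_i = n - H_i, where H_i < n drops along envy.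
potential-valid : ∀ n h h' {P : Set} (D : Dec P) → h < n → h' < n → (P → h' < h) →
  pos (n ∸ h) ℤ.< pos (n ∸ h') ℤ.+ pos n ℤ.* (pos 1 ℤ.- pos (b2n (does D)))
potential-valid n h h' (yes p) h<n _ drop
  rewrite ℤP.*-zeroʳ (pos n) | ℤP.+-identityʳ (pos (n ∸ h')) =
  +<+ (NP.∸-monoʳ-< (drop p) (NP.<⇒≤ h<n))
potential-valid n h h' (no _) _ h'<n _ rewrite ℤP.*-identityʳ (pos n) =
  +<+ (NP.≤-<-trans (NP.m∸n≤m n h)
        (NP.≤-trans (NP.n<1+n n) (NP.+-monoˡ-≤ n (NP.m<n⇒0<n∸m h'<n))))

∈-tail : ∀ {a} {A : Set a} {x z : A} {xs} → x ≢ z → z ∈ x ∷ xs → z ∈ xs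
∈-tail x≢z (here z≡x)  = ⊥-elim (x≢z (sym z≡x))
∈-tail x≢z (there z∈) = z∈

rank-pos : ∀ {m} {L : List (Fin m)} {z} → z ∈ L → 1 ≤ rank L z
rank-pos {L = x ∷ xs} {z} z∈ with x ≟ z
... | yes _ = s≤s z≤n
... | no _  = s≤s z≤n

rank-injective : ∀ {m} {L : List (Fin m)} {a b} → a ∈ L → b ∈ L → rank L a ≡ rank L b → a ≡ b
rank-injective {L = x ∷ xs} {a} {b} a∈ b∈ same with x ≟ a | x ≟ b
... | yes refl | yes refl = refl
... | yes refl | no x≢b   = ⊥-elim (NP.<⇒≢ (rank-pos (∈-tail x≢b b∈)) (NP.suc-injective same))
... | no x≢a   | yes refl = ⊥-elim (NP.<⇒≢ (rank-pos (∈-tail x≢a a∈)) (NP.suc-injective (sym same)))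
... | no x≢a   | no x≢b   = rank-injective (∈-tail x≢a a∈) (∈-tail x≢b b∈) (NP.suc-injective same)

worst : ∀ {m p} (L : List (Fin m)) {P : Pred (Fin m) p} → Decidable P → ∃[ z ] (z ∈ L × P z) →
  ∃[ w ] (w ∈ L × P w × (∀ q → q ∈ L → P q → q ≡ w ⊎ rank L q < rank L w))
worst L {P} P? (z , z∈ , Pz) = w , proj₁ w∈×Pw , proj₂ w∈×Pw , last
  where
  w = argmax (rank L) z (filter P? L)
  w∈×Pw : w ∈ L × P w
  w∈×Pw = argmax-all (rank L) (z∈ , Pz) (All.tabulate (∈-filter⁻ P? {xs = L}))
  last : ∀ q → q ∈ L → P q → q ≡ w ⊎ rank L q < rank L w
  last q q∈ Pq with NP.m≤n⇒m<n∨m≡n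
    (v≤f[argmax]⁺ z (filter P? L) (inj₂ (Any.map (λ { refl → NP.≤-refl }) (∈-filter⁺ P? q∈ Pq))))
  ... | inj₁ before = inj₂ before
  ... | inj₂ same   = inj₁ (rank-injective q∈ (proj₁ w∈×Pw) same)

-- A map σ on a finite set admits no function strictly increasing along σ:
-- at a point where v is maximal, v t < v (σ t) is impossible.
no-ascent : ∀ {n} (σ : Fin (suc n) → Fin (suc n)) (v : Fin (suc n) → ℤ) →
  ¬ (∀ t → v t ℤ.< v (σ t))
no-ascent {n} σ v ascent = ℤP.<⇒≱ (ascent top) (ℤExtrema.v≤f[argmax]⁺ {f = v} zero (allFin (suc n))
  (inj₂ (Any.map (λ { refl → ℤP.≤-refl }) (∈-allFin (σ top)))))
  where
  module ℤExtrema = Data.List.Extrema ℤP.≤-totalOrder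
  top = ℤExtrema.argmax v zero (allFin (suc n))

next-periodic : ∀ {r a} {A : Set a} (w : ℕ → A) → w (suc r) ≡ w 0 →
  ∀ t → w (toℕ (next {r} t)) ≡ w (suc (toℕ t))
next-periodic {r} w closed t with suc (toℕ t) ≤? r
... | yes inside = cong w (trans (toℕ-fromℕ< _) (m≤n⇒m%n≡m inside))
... | no ¬inside = begin
  w (toℕ (next t))    ≡⟨ cong w (trans (toℕ-fromℕ< _) wraps) ⟩
  w 0                 ≡⟨ closed ⟨
  w (suc r)           ≡⟨ cong (λ k → w (suc k)) last ⟨
  w (suc (toℕ t))     ∎
  where
  last : toℕ t ≡ r
  last = NP.≤-antisym (NP.≤-pred (toℕ<n t)) (NP.≮⇒≥ ¬inside)
  wraps : suc (toℕ t) % suc r ≡ 0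
  wraps = trans (cong (λ k → suc k % suc r) last) (n%n≡0 (suc r))
  open ≡-Reasoning

module Walks {n : ℕ} (R : Fin n → Fin n → Set) where

  Walk : (ℕ → Fin n) → ℕ → Set
  Walk w m = ∀ k → k < m → R (w k) (w (suc k))

  cons : Fin n → (ℕ → Fin n) → ℕ → Fin n
  cons i w zero    = i
  cons i w (suc k) = w k

  cons-walk : ∀ {i w m} → R i (w 0) → Walk w m → Walk (cons i w) (suc m)
  cons-walk first W zero    _         = first
  cons-walk first W (suc k) (s≤s k<m) = W k k<m

  record Cycle : Set where
    constructor mkCycle
    field
      len     : ℕ
      len-pos : 1 ≤ len
      vertex  : ℕ → Fin n
      walk    : Walk vertex len
      closed  : vertex len ≡ vertex 0

  open Cycle

  Simple : Cycle → Set
  Simple C = Injective _≡_ _≡_ (λ (t : Fin (len C)) → vertex C (toℕ t))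

  cycle-between : ∀ {w m a b} → Walk w m → a < b → b ≤ m → w a ≡ w b → Cycle
  cycle-between {w} {m} {a} {b} W a<b b≤m same = record
    { len = b ∸ a ; len-pos = NP.m<n⇒0<n∸m a<b ; vertex = λ k → w (a + k)
    ; walk = step ; closed = trans (cong w (NP.m+[n∸m]≡n (NP.<⇒≤ a<b)))
                                   (trans (sym same) (cong w (sym (NP.+-identityʳ a)))) }
    where
    step : Walk (λ k → w (a + k)) (b ∸ a)
    step k k<b∸a = subst (λ j → R (w (a + k)) (w j)) (sym (NP.+-suc a k))
      (W (a + k) (NP.<-≤-trans (NP.+-monoʳ-< a k<b∸a)
                   (NP.≤-trans (NP.≤-reflexive (NP.m+[n∸m]≡n (NP.<⇒≤ a<b))) b≤m)))

  long-walk-cycle : ∀ {w m} → Walk w m → n ≤ m → Cycle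
  long-walk-cycle {w} W n≤m with pigeonhole (NP.n<1+n n) (λ (t : Fin (suc n)) → w (toℕ t))
  ... | a , b , a<b , same = cycle-between W a<b (NP.≤-trans (NP.≤-pred (toℕ<n b)) n≤m) same

  cut-shorter : ∀ {x y l fuel} → y < l → l ≤ suc fuel → y ∸ x ≤ fuel
  cut-shorter {x} {y} y<l l≤ = NP.≤-pred (NP.≤-trans (s≤s (NP.m∸n≤m y x)) (NP.≤-trans y<l l≤))

  -- every cycle contains a simple one: cut the cycle at a repeated vertex
  -- (shortening it) until no vertex repeats; fuel bounds the length
  simple-cycle : Cycle → Σ Cycle Simple
  simple-cycle C = shorten (len C) C NP.≤-refl
    where
    shorten : ∀ fuel (C : Cycle) → len C ≤ fuel → Σ Cycle Simple
    shorten zero C bound = ⊥-elim (NP.<⇒≱ (len-pos C) bound)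
    shorten (suc fuel) C bound
      with FinP.any? (λ a → FinP.any? (λ b →
             (vertex C (toℕ a) ≟ vertex C (toℕ b)) ×-dec ¬? (a ≟ b)))
    ... | no noRepeat = C , injective
      where
      injective : Simple C
      injective {a} {b} same with a ≟ b
      ... | yes a≡b = a≡b
      ... | no a≢b  = ⊥-elim (noRepeat (a , b , same , a≢b))
    ... | yes (a , b , same , a≢b) with NP.<-cmp (toℕ a) (toℕ b)
    ...   | tri≈ _ a≡b _ = ⊥-elim (a≢b (toℕ-injective a≡b))
    ...   | tri< a<b _ _ = shorten fuel (cycle-between (walk C) a<b (NP.<⇒≤ (toℕ<n b)) same)
                                 (cut-shorter {toℕ a} (toℕ<n b) bound)
    ...   | tri> _ _ b<a = shorten fuel (cycle-between (walk C) b<a (NP.<⇒≤ (toℕ<n a)) (sym same))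
                                 (cut-shorter {toℕ b} (toℕ<n a) bound)

  -- In an acyclic graph, the length of a longest walk from i is a height
  -- function: it is below n and strictly decreases along every edge.
  module Height (R? : ∀ i i' → Dec (R i i')) (acyclic : ¬ Cycle) where

    WalkFrom : Fin n → ℕ → Set
    WalkFrom i m = ∃[ w ] (w 0 ≡ i × Walk w m)

    via : ∀ {i i'} → Dec (R i i') → ℕ → ℕ
    via D m = if does D then suc m else 0

    -- height t i: the length of a longest walk from i among those of length at most t;
    -- candidate t i i': the longest such walk of length at most t+1 whose first step is to i'
    height    : ℕ → Fin n → ℕ
    candidate : ℕ → Fin n → Fin n → ℕ
    height zero    i = 0
    height (suc t) i = candidate t i (argmax (candidate t i) i (allFin n))
    candidate t i i' = via (R? i i') (height t i')

    height-sound : ∀ t i → WalkFrom i (height t i)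
    height-sound zero    i = (λ _ → i) , refl , λ _ ()
    height-sound (suc t) i = extend (R? i i*) (height-sound t i*)
      where
      i* = argmax (candidate t i) i (allFin n)
      extend : ∀ {i' m} (D : Dec (R i i')) → WalkFrom i' m → WalkFrom i (via D m)
      extend (yes first) (w , refl , W) = cons i w , refl , cons-walk first W
      extend (no _)      _              = (λ _ → i) , refl , λ _ ()

    height-complete : ∀ {w m} t → Walk w m → m ≤ t → m ≤ height t (w 0)
    height-complete {m = zero}           t       W _         = z≤n
    height-complete {w} {m = suc m} (suc t) W (s≤s m≤t) =
      NP.≤-trans (stepFirst (R? (w 0) (w 1)))
        (v≤f[argmax]⁺ {f = candidate t (w 0)} (w 0) (allFin n)
          (inj₂ (Any.map (λ { refl → NP.≤-refl }) (∈-allFin (w 1)))))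
      where
      rest : m ≤ height t (w 1)
      rest = height-complete t (λ k k<m → W (suc k) (s≤s k<m)) m≤t
      stepFirst : (D : Dec (R (w 0) (w 1))) → suc m ≤ via D (height t (w 1))
      stepFirst (yes _)  = s≤s rest
      stepFirst (no ¬e)  = ⊥-elim (¬e (W 0 (s≤s z≤n)))

    H : Fin n → ℕ
    H = height n

    H-bound : ∀ i → H i < n
    H-bound i with height-sound n i
    ... | w , _ , W = NP.≰⇒> (λ n≤H → acyclic (long-walk-cycle W n≤H))

    H-decreasing : ∀ {i i'} → R i i' → H i' < H i
    H-decreasing {i} {i'} e with height-sound n i'
    ... | w , refl , W = height-complete n (cons-walk {i} e W) (H-bound i')

module SPA (I : Instance) where
  open Instance I

  LP⇒lec : ∀ {k j} → j ∈ LP k → lec j ≡ k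
  LP⇒lec {k} {j} = Equivalence.to (LP-exact k j)

  lec⇒LP : ∀ {k j} → lec j ≡ k → j ∈ LP k
  lec⇒LP {k} {j} = Equivalence.from (LP-exact k j)

  Prefers-irrefl : ∀ {m} {L : List (Fin m)} {a} → ¬ Prefers L a a
  Prefers-irrefl (_ , _ , lt) = NP.<-irrefl refl lt

  Improves : Rel I → Fin n₁ → Fin n₂ → Set
  Improves M i j = Unassigned I M i ⊎ ∃[ j' ] (M i j' ≡ true × Prefers (A i) j j')

  LecturerAccepts : Rel I → Fin n₁ → Fin n₂ → Set
  LecturerAccepts M i j =
    (∃[ j' ] (M i j' ≡ true × lec j' ≡ lec j × Prefers (LP (lec j)) j j'))
    ⊎ (¬ AssignedToLec I M i (lec j) × lecLoad I M (lec j) < d (lec j))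
    ⊎ (¬ AssignedToLec I M i (lec j) ×
         ∃[ w ] (WorstNonEmpty I M (lec j) w × Prefers (LP (lec j)) j w))

  module Table (M : Rel I) where

    Y : Fin n₁ → Fin n₂ → ℕ
    Y i j = b2n (M i j)

    Y-true : ∀ {i j} → M i j ≡ true → 1 ≤ Y i j
    Y-true M≡ rewrite M≡ = s≤s z≤n

    Y-positive : ∀ {i j} → 1 ≤ Y i j → M i j ≡ true
    Y-positive {i} {j} 1≤ with M i j
    ... | true  = refl
    ... | false = ⊥-elim (NP.<⇒≱ 1≤ z≤n)

    Y-zero : ∀ {i j} → Y i j ≡ 0 → M i j ≡ false
    Y-zero {i} {j} Y≡0 with M i j
    ... | true  = ⊥-elim (NP.1+n≢0 Y≡0)
    ... | false = refl

    module Sums (x : Fin n₁ → Fin n₂ → ℤ) (x≡Y : ∀ i j → x i j ≡ pos (Y i j)) where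

      rowSum : ∀ i L → sumLZ L (x i) ≡ pos (sumL L (Y i))
      rowSum i L = trans (sumLZ-ext L (x≡Y i)) (sumLZ-pos L (Y i))

      totalSum : ∀ (L : Fin n₁ → List (Fin n₂)) →
        sumFinZ n₁ (λ i → sumLZ (L i) (x i)) ≡ pos (sumFin n₁ (λ i → sumL (L i) (Y i)))
      totalSum L = trans (sumFinZ-ext n₁ (λ i → rowSum i (L i))) (sumFinZ-pos n₁ _)

      projSum : ∀ j → sumFinZ n₁ (λ i → x i j) ≡ pos (projLoad I M j)
      projSum j = trans (sumFinZ-ext n₁ (λ i → x≡Y i j)) (sumFinZ-pos n₁ _)

      objective-counts : (∀ i j → M i j ≡ true → j ∈ A i) →
        sumFinZ n₁ (λ i → sumLZ (A i) (x i)) ≡ pos (card I M)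
      objective-counts acceptable = trans (totalSum A) (cong pos (sumFin-ext n₁ λ i →
        sumL≡sumFin (A i) (A-unique i) (Y i) λ j j∉ →
          not-positive (λ 1≤Y → j∉ (acceptable i j (Y-positive 1≤Y)))))

  module Matched (M : Rel I) (isM : IsMatching I M) where
    open IsMatching isM
    open Table M

    row-≤1 : ∀ i {L} → Unique L → sumL L (Y i) ≤ 1
    row-≤1 i u = sumL-≤1 (Y i) u (λ z → b2n≤1 (M i z))
      (λ a b 1≤a 1≤b → atMostOne i a b (Y-positive 1≤a) (Y-positive 1≤b))

    S-row-≤1 : ∀ i j → sumL (Sset I i j) (Y i) ≤ 1
    S-row-≤1 i j = row-≤1 i (UniqueP.filter⁺ _ (A-unique i))

    T-row-≤1 : ∀ i j k → sumL (Tset I k j) (Y i) ≤ 1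
    T-row-≤1 i j k = row-≤1 i (UniqueP.filter⁺ _ (LP-unique k))

    LP-row-≤1 : ∀ i k → sumL (LP k) (Y i) ≤ 1
    LP-row-≤1 i k = row-≤1 i (LP-unique k)

    improves⇒S-empty : ∀ {i j} → Improves M i j → sumL (Sset I i j) (Y i) ≡ 0
    improves⇒S-empty {i} {j} improves = sumL-zero (Sset I i j) λ q q∈S →
      not-positive λ 1≤Y →
        excluded (∈-filter⁻ (λ j' → rank (A i) j' ≤? rank (A i) j) {xs = A i} q∈S)
                 (Y-positive 1≤Y) improves
      where
      excluded : ∀ {q} → q ∈ A i × rank (A i) q ≤ rank (A i) j → M i q ≡ true → Improves M i j → ⊥
      excluded {q} _ Mq (inj₁ unassigned) with trans (sym Mq) (unassigned q)
      ... | ()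
      excluded (_ , q≤j) Mq (inj₂ (j' , Mj' , (_ , _ , j<j'))) with atMostOne i _ j' Mq Mj'
      ... | refl = NP.<⇒≱ j<j' q≤j

    S-empty⇒improves : ∀ {i j} → j ∈ A i → sumL (Sset I i j) (Y i) ≡ 0 →
      M i j ≡ false × Improves M i j
    S-empty⇒improves {i} {j} j∈A empty = Y-zero (absent (inS j∈A NP.≤-refl)) , improves
      where
      inS : ∀ {q} → q ∈ A i → rank (A i) q ≤ rank (A i) j → q ∈ Sset I i j
      inS = ∈-filter⁺ (λ j' → rank (A i) j' ≤? rank (A i) j)
      absent : ∀ {q} → q ∈ Sset I i j → Y i q ≡ 0
      absent q∈S = NP.n≤0⇒n≡0 (subst (Y i _ ≤_) empty (sumL-term (Y i) q∈S))
      improves : Improves M i j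
      improves with FinP.any? (λ j' → 1 ≤? Y i j')
      ... | no unassigned = inj₁ λ j' → Y-zero (not-positive λ 1≤Y → unassigned (j' , 1≤Y))
      ... | yes (j' , 1≤Y) = inj₂ (j' , Mj' , j∈A , j'∈A ,
                                    NP.≰⇒> λ j'≤j → NP.<⇒≢ 1≤Y (sym (absent (inS j'∈A j'≤j))))
        where
        Mj' = Y-positive 1≤Y
        j'∈A = acceptable i j' Mj'

    unassigned⇒β-empty : ∀ {i k} → ¬ AssignedToLec I M i k → sumL (LP k) (Y i) ≡ 0
    unassigned⇒β-empty {i} {k} notAssigned = sumL-zero (LP k) λ q q∈LP →
      not-positive λ 1≤Y → notAssigned (q , Y-positive 1≤Y , LP⇒lec q∈LP)

    β-empty⇒unassigned : ∀ {i k} → sumL (LP k) (Y i) ≡ 0 → ¬ AssignedToLec I M i k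
    β-empty⇒unassigned {i} empty (j' , Mj' , lec≡k) =
      NP.<⇒≱ (NP.≤-trans (Y-true Mj') (sumL-term (Y i) (lec⇒LP lec≡k))) (NP.≤-reflexive empty)

    worse⇒γ : ∀ {i j j' k} → M i j' ≡ true → j' ∈ LP k → rank (LP k) j < rank (LP k) j' →
      1 ≤ sumL (Tset I k j) (Y i)
    worse⇒γ {i} {j} {k = k} Mj' j'∈ j<j' = NP.≤-trans (Y-true Mj')
      (sumL-term (Y i) (∈-filter⁺ (λ q → rank (LP k) j <? rank (LP k) q) j'∈ j<j'))

    γ⇒worse : ∀ {i j k} → 1 ≤ sumL (Tset I k j) (Y i) →
      ∃[ j' ] (M i j' ≡ true × j' ∈ LP k × rank (LP k) j < rank (LP k) j')
    γ⇒worse {i} {j} {k} 1≤γ with sumL-positive (Tset I k j) (Y i) 1≤γ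
    ... | j' , j'∈T , 1≤Y with ∈-filter⁻ (λ q → rank (LP k) j <? rank (LP k) q) {xs = LP k} j'∈T
    ...   | j'∈ , j<j' = j' , Y-positive 1≤Y , j'∈ , j<j'

    DLoad : Fin n₃ → Fin n₂ → ℕ
    DLoad k j = sumFin n₁ (λ i → sumL (Dset I k j) (Y i))

    DLoad-≤ : ∀ k j → DLoad k j ≤ lecLoad I M k
    DLoad-≤ k j = sumFin-mono n₁ (λ i → sumL-filter-≤ _ (LP k) (Y i))

    worse-nonempty⇒DLoad< : ∀ {k j w} → w ∈ LP k → 0 < projLoad I M w →
      rank (LP k) j < rank (LP k) w → DLoad k j < d k
    worse-nonempty⇒DLoad< {k} {j} {w} w∈ nonempty j<w = begin-strict
      DLoad k j                                                  <⟨ NP.m<m+n _ nonempty ⟩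
      DLoad k j + projLoad I M w                                 ≡⟨ sumFin-+ n₁ _ _ ⟨
      sumFin n₁ (λ i → sumL (Dset I k j) (Y i) + Y i w)          ≤⟨ sumFin-mono n₁ perStudent ⟩
      lecLoad I M k                                              ≤⟨ lecCap k ⟩
      d k                                                        ∎
      where
      open NP.≤-Reasoning
      perStudent : ∀ i → sumL (Dset I k j) (Y i) + Y i w ≤ sumL (LP k) (Y i)
      perStudent i = sumL-filter-+ (λ j' → rank (LP k) j' ≤? rank (LP k) j) (Y i) w∈ (NP.<⇒≱ j<w)

    worst-nonempty : ∀ {k w} → w ∈ LP k → 0 < projLoad I M w →
      ∃[ w₀ ] (WorstNonEmpty I M k w₀ × rank (LP k) w ≤ rank (LP k) w₀)
    worst-nonempty {k} {w} w∈ nonempty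
      with worst (LP k) (λ q → 0 <? projLoad I M q) (w , w∈ , nonempty)
    ... | w₀ , w₀∈ , nonempty₀ , last =
      w₀ , (LP⇒lec w₀∈ , nonempty₀ ,
            λ q lec≡k ne → prefers (lec⇒LP lec≡k) (last q (lec⇒LP lec≡k) ne))
         , atMost (last w w∈ nonempty)
      where
      prefers : ∀ {q} → q ∈ LP k → q ≡ w₀ ⊎ rank (LP k) q < rank (LP k) w₀ →
        q ≡ w₀ ⊎ Prefers (LP k) q w₀
      prefers _  (inj₁ q≡w₀)  = inj₁ q≡w₀
      prefers q∈ (inj₂ q<w₀) = inj₂ (q∈ , w₀∈ , q<w₀)
      atMost : w ≡ w₀ ⊎ rank (LP k) w < rank (LP k) w₀ → rank (LP k) w ≤ rank (LP k) w₀
      atMost (inj₁ refl) = NP.≤-refl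
      atMost (inj₂ w<w₀) = NP.<⇒≤ w<w₀

    inD? : (k : Fin n₃) (j j' : Fin n₂) → Dec (rank (LP k) j' ≤ rank (LP k) j)
    inD? k j j' = rank (LP k) j' ≤? rank (LP k) j

    beyondD : Fin n₃ → Fin n₂ → ℕ
    beyondD k j = sumFin n₁ (λ i → sumL (LP k) (erase (inD? k j) (Y i)))

    lecLoad-split : ∀ k j → lecLoad I M k ≡ DLoad k j + beyondD k j
    lecLoad-split k j =
      trans (sumFin-ext n₁ (λ i → sumL-filter (inD? k j) (LP k) (Y i))) (sumFin-+ n₁ _ _)

    full⇒worse-nonempty : ∀ {k j} → ¬ lecLoad I M k < d k → DLoad k j < d k →
      ∃[ w ] (w ∈ LP k × 0 < projLoad I M w × rank (LP k) j < rank (LP k) w)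
    full⇒worse-nonempty {k} {j} full room with 1 ≤? beyondD k j
    ... | no none = ⊥-elim (NP.<⇒≱ room (begin
          d k                          ≤⟨ NP.≮⇒≥ full ⟩
          lecLoad I M k                ≡⟨ lecLoad-split k j ⟩
          DLoad k j + beyondD k j      ≡⟨ cong (DLoad k j +_) (not-positive none) ⟩
          DLoad k j + 0                ≡⟨ NP.+-identityʳ _ ⟩
          DLoad k j                    ∎))
      where open NP.≤-Reasoning
    ... | yes some with sumFin-positive n₁ _ some
    ...   | i , 1≤row with sumL-positive (LP k) (erase (inD? k j) (Y i)) 1≤row
    ...     | w , w∈ , 1≤erased with erase-positive (inD? k j) (Y i) 1≤erased
    ...       | w∉D , 1≤Y = w , w∈ , NP.≤-trans 1≤Y (sumFin-term n₁ (λ i' → Y i' w) i) , NP.≰⇒> w∉D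

    DLoad<⇒room : ∀ {k j} → j ∈ LP k → DLoad k j < d k →
      lecLoad I M k < d k ⊎ ∃[ w ] (WorstNonEmpty I M k w × Prefers (LP k) j w)
    DLoad<⇒room {k} {j} j∈ room with lecLoad I M k <? d k
    ... | yes under = inj₁ under
    ... | no full with full⇒worse-nonempty full room
    ...   | w , w∈ , nonempty , j<w with worst-nonempty w∈ nonempty
    ...     | w₀ , worst₀ , w≤w₀ =
      inj₂ (w₀ , worst₀ , j∈ , lec⇒LP (proj₁ worst₀) , NP.<-≤-trans j<w w≤w₀)

  module FromSolution (S : Solution I) (F : Feasible I S) where
    open Solution S
    open Feasible F
    open DecMembership (_≟_ {n₂}) using (_∈?_)

    M : Rel I
    M = matchingOf I S

    open Table M

    x≡Y : ∀ i j → x i j ≡ pos (Y i j)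
    x≡Y i j with x-bin i j
    ... | inj₁ x≡0 rewrite x≡0 = refl
    ... | inj₂ x≡1 rewrite x≡1 = refl

    x≡1 : ∀ {i j} → M i j ≡ true → x i j ≡ pos 1
    x≡1 {i} {j} Mij = trans (x≡Y i j) (cong (λ b → pos (b2n b)) Mij)

    open Sums x x≡Y

    acceptable : ∀ i j → M i j ≡ true → j ∈ A i
    acceptable i j Mij = decidable-stable (j ∈? A i) λ j∉ →
      NP.<⇒≢ (Y-true Mij) (sym (ℤP.+-injective (trans (sym (x≡Y i j)) (x-acc i j j∉))))

    row-≤1 : ∀ i → sumL (A i) (Y i) ≤ 1
    row-≤1 i = ℤP.drop‿+≤+ (subst (ℤ._≤ pos 1) (rowSum i (A i)) (c1 i))

    -- two distinct projects of s_i would contribute 2 to the sum in (1)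
    atMostOne : ∀ i j j' → M i j ≡ true → M i j' ≡ true → j ≡ j'
    atMostOne i j j' Mj Mj' = decidable-stable (j ≟ j') λ j≢j' → NP.<⇒≱ (s≤s (s≤s z≤n))
      (NP.≤-trans (NP.+-mono-≤ (Y-true Mj) (Y-true Mj'))
        (NP.≤-trans (sumL-two (Y i) (A-unique i) (acceptable i j Mj) (acceptable i j' Mj') j≢j')
          (row-≤1 i)))

    isMatching : IsMatching I M
    isMatching = record
      { acceptable = acceptable
      ; atMostOne  = atMostOne
      ; projCap    = λ j → ℤP.drop‿+≤+ (subst (ℤ._≤ pos (c j)) (projSum j) (c2 j))
      ; lecCap     = λ k → ℤP.drop‿+≤+ (subst (ℤ._≤ pos (d k)) (totalSum (λ _ → LP k)) (c3 k))
      }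

    open Matched M isMatching

    α-one : ∀ {j} → projLoad I M j < c j → α j ≡ pos 1
    α-one {j} under = indicator-forced under (α-bin j) (projSum j) (c4 j)

    δ-one : ∀ {k} → lecLoad I M k < d k → δ k ≡ pos 1
    δ-one {k} under = indicator-forced under (δ-bin k) (totalSum (λ _ → LP k)) (c5 k)

    η-one : ∀ {j} → DLoad (lec j) j < d (lec j) → η j (lec j) ≡ pos 1
    η-one {j} under = indicator-forced under (η-bin j (lec j))
      (totalSum (λ _ → Dset I (lec j) j)) (c6 (lec j) j refl)

    θ-one : ∀ {i j} → Improves M i j → sumLZ (Sset I i j) (x i) ≡ pos 0
    θ-one {i} {j} improves = trans (rowSum i (Sset I i j)) (cong pos (improves⇒S-empty improves))

    β-zero : ∀ {i k} → ¬ AssignedToLec I M i k → sumLZ (LP k) (x i) ≡ pos 0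
    β-zero {i} {k} notAssigned = trans (rowSum i (LP k)) (cong pos (unassigned⇒β-empty notAssigned))

    -- each lecturer condition of a blocking pair violates one of (7), (8), (9)
    noBlocking : ∀ i j → ¬ BlockingPair I M i j
    noBlocking i j (j∈A , _ , improves , under , inj₁ (j' , Mj' , _ , (_ , j'∈ , j<j'))) =
      c7-violated (θ-one improves) (α-one under) (rowSum i (Tset I (lec j) j))
                  (worse⇒γ Mj' j'∈ j<j') (c7 i j j∈A)
    noBlocking i j (j∈A , _ , improves , under , inj₂ (inj₁ (notAssigned , room))) =
      c89-violated (θ-one improves) (α-one under) (β-zero notAssigned) (δ-one room) (c8 i j j∈A)
    noBlocking i j (j∈A , _ , improves , under ,
                    inj₂ (inj₂ (notAssigned , w , (_ , nonempty , _) , (_ , w∈ , j<w)))) =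
      c89-violated (θ-one improves) (α-one under) (β-zero notAssigned)
                   (η-one (worse-nonempty⇒DLoad< w∈ nonempty j<w)) (c9 i j j∈A)

    -- along a coalition, (10) forces e = 1 and then (11) makes v strictly increase
    -- around a cycle, which is impossible
    noCoalition : ¬ Coalition I M
    noCoalition C = no-ascent next (λ t → v (f t)) ascent
      where
      open Coalition C
      distinct : ∀ t → f t ≢ f (next t)
      distinct t f≡ with atMostOne (f t) (g t) (g (next t)) (assigned t)
                           (subst (λ i → M i (g (next t)) ≡ true) (sym f≡) (assigned (next t)))
      ... | g≡ = Prefers-irrefl (subst (λ p → Prefers (A (f t)) (g (next t)) p) g≡ (improves t))
      ascent : ∀ t → v (f t) ℤ.< v (f (next t))
      ascent t = potential-increases n₁
        (envy-forced (x≡1 (assigned t)) (x≡1 (assigned (next t))) (e-bin _ _ (distinct t))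
                     (c10 (f t) (f (next t)) (g t) (g (next t)) (distinct t) (improves t)))
        (c11 (f t) (f (next t)) (distinct t))

    stable : Stable I M
    stable = record { matching = isMatching ; noBlocking = noBlocking ; noCoalition = noCoalition }

    objective≡card : objective I S ≡ pos (card I M)
    objective≡card = objective-counts acceptable

  module FromStable (M : Rel I) (st : Stable I M) where
    open Stable st renaming (matching to isMatching)
    open IsMatching isMatching
    open Table M
    open Matched M isMatching
    open DecMembership (_≟_ {n₂}) using (_∈?_)

    Envy : Fin n₁ → Fin n₁ → Set
    Envy i i' = Σ (Fin n₂) λ j → Σ (Fin n₂) λ j' →
      M i j ≡ true × M i' j' ≡ true × Prefers (A i) j' j

    Envy? : ∀ i i' → Dec (Envy i i')
    Envy? i i' = FinP.any? λ j → FinP.any? λ j' →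
      (M i j BoolP.≟ true) ×-dec (M i' j' BoolP.≟ true) ×-dec
      ((j' ∈? A i) ×-dec (j ∈? A i) ×-dec (rank (A i) j' <? rank (A i) j))

    -- a student does not envy himself, since he holds one project
    no-self-envy : ∀ {i} → ¬ Envy i i
    no-self-envy {i} (j , j' , Mj , Mj' , j'<j) with atMostOne i j j' Mj Mj'
    ... | refl = Prefers-irrefl j'<j

    open Walks Envy

    coalition : ∀ r (w : ℕ → Fin n₁) → Walk w (suc r) → w (suc r) ≡ w 0 → 1 ≤ r →
      Injective _≡_ _≡_ (λ (t : Fin (suc r)) → w (toℕ t)) → Coalition I M
    coalition r w W closed r-pos distinct = record
      { r = r ; r-pos = r-pos ; f = f ; f-inj = distinct ; g = g
      ; assigned = assigned ; improves = improves }
      where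
      f : Fin (suc r) → Fin n₁
      f t = w (toℕ t)
      g : Fin (suc r) → Fin n₂
      g t = proj₁ (W (toℕ t) (toℕ<n t))
      assigned : ∀ t → M (f t) (g t) ≡ true
      assigned t = proj₁ (proj₂ (proj₂ (W (toℕ t) (toℕ<n t))))
      improves : ∀ t → Prefers (A (f t)) (g (next t)) (g t)
      improves t with W (toℕ t) (toℕ<n t)
      ... | _ , j' , _ , Mj' , prefers
        with atMostOne (w (suc (toℕ t))) j' (g (next t)) Mj'
               (subst (λ i → M i (g (next t)) ≡ true) (next-periodic w closed t)
                      (assigned (next t)))
      ... | refl = prefers

    -- stability excludes envy cycles: a shortest one is a self-envy or a coalition
    envy-acyclic : ¬ Cycle
    envy-acyclic C with simple-cycle C
    ... | mkCycle (suc zero) _ w W closed , _ =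
      no-self-envy (subst (Envy (w 0)) closed (W 0 (s≤s z≤n)))
    ... | mkCycle (suc (suc r)) _ w W closed , simple =
      noCoalition (coalition (suc r) w W closed (s≤s z≤n) simple)

    open Height Envy? envy-acyclic

    -- the solution encoding M: each indicator variable records its intended condition,
    -- and v_i = n₁ - H_i orders the students against the envy relation
    solution : Solution I
    solution = record
      { x = λ i j → pos (Y i j)
      ; α = λ j → pos (b2n (does (projLoad I M j <? c j)))
      ; δ = λ k → pos (b2n (does (lecLoad I M k <? d k)))
      ; η = λ j k → pos (b2n (does (DLoad k j <? d k)))
      ; e = λ i i' → pos (b2n (does (Envy? i i')))
      ; v = λ i → pos (n₁ ℕ.∸ H i)
      }

    open Sums (λ i j → pos (Y i j)) (λ i j → refl)

    blocking : ∀ {i j} → j ∈ A i → sumL (Sset I i j) (Y i) ≡ 0 → projLoad I M j < c j →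
      LecturerAccepts M i j → BlockingPair I M i j
    blocking j∈A empty under accepts =
      let (unmatched , improves) = S-empty⇒improves j∈A empty
      in j∈A , unmatched , improves , under , accepts

    -- (7)-(9) hold: each violation would exhibit a blocking pair of type (a), (b), (c)
    c7-holds : ∀ i j → j ∈ A i →
      θ I solution i j ℤ.+ Solution.α solution j ℤ.+ γ I solution i j (lec j) ℤ.≤ pos 2
    c7-holds i j j∈A = c7-table (rowSum i (Sset I i j)) (rowSum i (Tset I (lec j) j))
      (S-row-≤1 i j) (b2n≤1 _) (T-row-≤1 i j (lec j))
      λ { (empty , under , 1≤γ) →
            let (j' , Mj' , j'∈ , j<j') = γ⇒worse 1≤γ
            in noBlocking i j (blocking j∈A empty (b2n-does (projLoad I M j <? c j) under)
                 (inj₁ (j' , Mj' , LP⇒lec j'∈ , lec⇒LP refl , j'∈ , j<j'))) }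

    c8-holds : ∀ i j → j ∈ A i →
      θ I solution i j ℤ.+ Solution.α solution j ℤ.+ (pos 1 ℤ.- β I solution i (lec j))
        ℤ.+ Solution.δ solution (lec j) ℤ.≤ pos 3
    c8-holds i j j∈A = c89-table (rowSum i (Sset I i j)) (rowSum i (LP (lec j)))
      (S-row-≤1 i j) (b2n≤1 _) (LP-row-≤1 i (lec j)) (b2n≤1 _)
      λ { (empty , under , β-empty , room) →
            noBlocking i j (blocking j∈A empty (b2n-does (projLoad I M j <? c j) under)
              (inj₂ (inj₁ (β-empty⇒unassigned β-empty ,
                           b2n-does (lecLoad I M (lec j) <? d (lec j)) room)))) }

    c9-holds : ∀ i j → j ∈ A i →
      θ I solution i j ℤ.+ Solution.α solution j ℤ.+ (pos 1 ℤ.- β I solution i (lec j))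
        ℤ.+ Solution.η solution j (lec j) ℤ.≤ pos 3
    c9-holds i j j∈A = c89-table (rowSum i (Sset I i j)) (rowSum i (LP (lec j)))
      (S-row-≤1 i j) (b2n≤1 _) (LP-row-≤1 i (lec j)) (b2n≤1 _)
      λ { (empty , under , β-empty , room) →
            noBlocking i j (blocking j∈A empty (b2n-does (projLoad I M j <? c j) under)
              (lecturer (β-empty⇒unassigned β-empty)
                 (DLoad<⇒room (lec⇒LP refl) (b2n-does (DLoad (lec j) j <? d (lec j)) room)))) }
      where
      lecturer : ¬ AssignedToLec I M i (lec j) →
        lecLoad I M (lec j) < d (lec j) ⊎
          ∃[ w ] (WorstNonEmpty I M (lec j) w × Prefers (LP (lec j)) j w) →
        LecturerAccepts M i j
      lecturer notAssigned (inj₁ under) = inj₂ (inj₁ (notAssigned , under))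
      lecturer notAssigned (inj₂ worse) = inj₂ (inj₂ (notAssigned , worse))

    feasible : Feasible I solution
    feasible = record
      { x-bin = λ i j → b2n-binary (M i j)
      ; x-acc = λ i j j∉ → cong pos (not-positive λ 1≤Y → j∉ (acceptable i j (Y-positive 1≤Y)))
      ; α-bin = λ j → b2n-binary _
      ; δ-bin = λ k → b2n-binary _
      ; η-bin = λ j k → b2n-binary _
      ; e-bin = λ i i' _ → b2n-binary _
      ; c1 = λ i → subst (ℤ._≤ pos 1) (sym (rowSum i (A i))) (+≤+ (row-≤1 i (A-unique i)))
      ; c2 = λ j → subst (ℤ._≤ pos (c j)) (sym (projSum j)) (+≤+ (projCap j))
      ; c3 = λ k → subst (ℤ._≤ pos (d k)) (sym (totalSum (λ _ → LP k))) (+≤+ (lecCap k))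
      ; c4 = λ j → indicator-valid (c j) _ (projSum j) (projCap j) (projLoad I M j <? c j)
      ; c5 = λ k → indicator-valid (d k) _ (totalSum (λ _ → LP k)) (lecCap k) (lecLoad I M k <? d k)
      ; c6 = λ k j _ → indicator-valid (d k) _ (totalSum (λ _ → Dset I k j))
                         (NP.≤-trans (DLoad-≤ k j) (lecCap k)) (DLoad k j <? d k)
      ; c7 = c7-holds
      ; c8 = c8-holds
      ; c9 = c9-holds
      ; c10 = λ i i' j j' _ j'<j →
                c10-table (M i j) (M i' j') (Envy? i i') (λ Mj Mj' → j , j' , Mj , Mj' , j'<j)
      ; c11 = λ i i' _ →
                potential-valid n₁ (H i) (H i') (Envy? i i') (H-bound i) (H-bound i') H-decreasing
      }

    objective≡card : objective I solution ≡ pos (card I M)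
    objective≡card = objective-counts acceptable

theorem1 : (I : Instance) (S : Solution I) → Feasible I S →
    (Optimal I S → MaxCardStable I (matchingOf I S)) ×
    (MaxCardStable I (matchingOf I S) → Optimal I S)
theorem1 I S F = optimal⇒maximum , maximum⇒optimal
  where
  open SPA I
  module Encoded = FromSolution S F

  -- every stable matching is encoded by a feasible solution of the same size
  optimal⇒maximum : Optimal I S → MaxCardStable I (matchingOf I S)
  optimal⇒maximum (_ , best) = Encoded.stable , λ M' stable' →
    let module E' = FromStable M' stable'
    in ℤP.drop‿+≤+ (subst₂ ℤ._≤_ E'.objective≡card Encoded.objective≡card
                                 (best E'.solution E'.feasible))

  -- every feasible solution encodes a stable matching of size equal to its objective
  maximum⇒optimal : MaxCardStable I (matchingOf I S) → Optimal I S
  maximum⇒optimal (_ , largest) = F , λ S' F' →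
    let module E' = FromSolution S' F'
    in subst₂ ℤ._≤_ (sym E'.objective≡card) (sym Encoded.objective≡card)
                    (+≤+ (largest E'.M E'.stable))
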